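{- No rookwise connected snake making $3$ or more U-turns can tile the plane (translations and rotations allowed); moreover, for any finite collection of rookwise connected snakes each making $3$ or more U-turns, the plane cannot be tiled by copies of members of this collection.
   Context: A polyomino is a finite set of unit grid squares; it is rookwise connected if its squares can be placed one at a time so that each square after the first shares an edge with a previously placed square. A "snake" is a polyomino no subset of whose squares forms a T-tetromino or a $2\times 2$ square tetromino (in any position/orientation). A snake "makes $n$ U-turns" if it has $n$ distinct subsets of squares each forming a U-pentomino (a $2\times 3$ rectangle with the middle square of one long side removed, in any orientation). Tiling the plane by copies of prototiles means covering the plane by their images under integer translations and rotations by multiples of $90$ degrees, with no two copies sharing a square. -}

module Defs where

open import Data.Integer using (ℤ; _+_; -_; +_)
open import Data.Nat using (ℕ)
open import Data.Fin using (Fin; zero; suc; toℕ)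
open import Data.Product using (_×_; _,_; Σ; ∃; ∃-syntax)
open import Data.Sum using (_⊎_)
open import Data.List using (List; []; _∷_; map)
open import Data.List.Membership.Propositional using (_∈_)
open import Data.List.Relation.Unary.Any using (Any)
open import Data.List.Relation.Unary.All using (All)
open import Data.List.Relation.Unary.Unique.Propositional using (Unique)
open import Data.List.Relation.Binary.Permutation.Propositional using (_↭_)
open import Data.Unit using (⊤)
open import Relation.Nullary using (¬_)
open import Relation.Binary.PropositionalEquality using (_≡_)
open import Function.Bundles using (_⇔_)

-- A unit square of the grid, named by the integer coordinates of its lower-left corner.
Cell : Set
Cell = ℤ × ℤ

infixl 6 _⊕_
_⊕_ : Cell → Cell → Cell
(a , b) ⊕ (c , d) = (a + c , b + d)

-- A polyomino: a finite set of cells, represented by a duplicate-free list.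
Polyomino : Set
Polyomino = List Cell

Adjacent : Cell → Cell → Set
Adjacent c d = (d ≡ c ⊕ (+ 1 , + 0)) ⊎ (d ≡ c ⊕ (- (+ 1) , + 0))
             ⊎ (d ≡ c ⊕ (+ 0 , + 1)) ⊎ (d ≡ c ⊕ (+ 0 , - (+ 1)))

-- A list read from right to left is a valid placement order: every square
-- after the first placed one shares an edge with a previously placed square.
-- (Good (c ∷ L): c is placed after all squares of L.)
GoodOrder : List Cell → Set
GoodOrder [] = ⊤
GoodOrder (c ∷ []) = ⊤
GoodOrder (c ∷ L@(_ ∷ _)) = Any (Adjacent c) L × GoodOrder L

RookConnected : Polyomino → Set
RookConnected P = ∃[ L ] (L ↭ P) × GoodOrder L

-- Rotation by 90 degrees counterclockwise about the origin (acting on cells).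
-- The square [x,x+1]×[y,y+1] is sent to [-y-1,-y]×[x,x+1].
rot90 : Cell → Cell
rot90 (x , y) = (- y + - (+ 1) , x)

rotN : ℕ → Cell → Cell
rotN ℕ.zero c = c
rotN (ℕ.suc n) c = rot90 (rotN n c)

rotate : Fin 4 → Cell → Cell
rotate r = rotN (toℕ r)

move : Fin 4 → Cell → Cell → Cell
move r t c = rotate r c ⊕ t

copy : Fin 4 → Cell → List Cell → List Cell
copy r t S = map (move r t) S

_⊆_ : List Cell → List Cell → Set
A ⊆ B = All (_∈ B) A

SameSet : List Cell → List Cell → Set
SameSet A B = (c : Cell) → (c ∈ A) ⇔ (c ∈ B)

T-tetromino : List Cell
T-tetromino = (+ 0 , + 0) ∷ (+ 1 , + 0) ∷ (+ 2 , + 0) ∷ (+ 1 , + 1) ∷ []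

O-tetromino : List Cell
O-tetromino = (+ 0 , + 0) ∷ (+ 1 , + 0) ∷ (+ 0 , + 1) ∷ (+ 1 , + 1) ∷ []

U-pentomino : List Cell
U-pentomino = (+ 0 , + 0) ∷ (+ 1 , + 0) ∷ (+ 2 , + 0) ∷ (+ 0 , + 1) ∷ (+ 2 , + 1) ∷ []

ContainsCopy : List Cell → Polyomino → Set
ContainsCopy S P = ∃[ r ] ∃[ t ] (copy r t S ⊆ P)

Snake : Polyomino → Set
Snake P = ¬ ContainsCopy T-tetromino P × ¬ ContainsCopy O-tetromino P

UTurn : Polyomino → Set
UTurn P = Σ (Fin 4 × Cell) λ { (r , t) → copy r t U-pentomino ⊆ P }

uCells : {P : Polyomino} → UTurn P → List Cell
uCells ((r , t) , _) = copy r t U-pentomino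

AtLeast3UTurns : Polyomino → Set
AtLeast3UTurns P = Σ (UTurn P) λ u₁ → Σ (UTurn P) λ u₂ → Σ (UTurn P) λ u₃ →
  ¬ SameSet (uCells u₁) (uCells u₂) × ¬ SameSet (uCells u₁) (uCells u₃) × ¬ SameSet (uCells u₂) (uCells u₃)

Placement : ℕ → Set
Placement k = Fin k × Fin 4 × Cell

placedCells : {k : ℕ} → (Fin k → Polyomino) → Placement k → List Cell
placedCells tiles (i , r , t) = copy r t (tiles i)

-- The plane is tiled by copies of the prototiles: each cell c is assigned the copy f c
-- containing it, and every cell of that copy is assigned the same copy.  Hence the copies
-- in the image of f cover the plane and no two distinct copies share a square.
TilesPlane : {k : ℕ} → (Fin k → Polyomino) → Set
TilesPlane {k} tiles = Σ (Cell → Placement k) λ f → ((c : Cell) → c ∈ placedCells tiles (f c))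
                         × ((c d : Cell) → d ∈ placedCells tiles (f c) → f d ≡ f c)

GoodSnake : Polyomino → Set
GoodSnake P = Unique P × RookConnected P × Snake P × AtLeast3UTurns P

module Submission where

-- Every U-turn has a notch, the missing middle square of its U. A snake contains no
-- T-tetromino, so the notch lies outside the snake while three of its four neighbours lie
-- inside; hence the tile covering the notch meets it in a cell with at most one neighbour
-- in that tile: an end. Without T-tetrominoes every cell has degree at most 2, so by the
-- handshake count a connected tile has at most two ends. Notches of distinct U-turns are
-- distinct cells. Thus of the 3s notches of the s tiles meeting an N × N window, at most 2s
-- are ends of tiles meeting the window; the other s or more lie outside the window but
-- within distance M of it, M bounding the tile sizes. As s ≥ N²/M while the frame of width
-- M around the window has only 4NM + 4M² cells, N = 8M² gives a contradiction.

open import Defs hiding (_⊆_)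
open import Data.Nat as ℕ using (ℕ; zero; suc; _+_; _*_; _≤_; _<_; z≤n; s≤s; _≤?_)
import Data.Nat.Properties as ℕₚ
open import Data.Nat.ListAction using (sum)
open import Data.Nat.Tactic.RingSolver using () renaming (solve-∀ to ℕ-solve)
open import Data.Integer as ℤ using (ℤ; +_; -[1+_])
import Data.Integer.Properties as ℤₚ
open import Data.Integer.Tactic.RingSolver using () renaming (solve-∀ to ℤ-solve)
open import Data.Fin using (Fin; zero; suc; toℕ)
import Data.Fin.Properties as Finₚ
open import Data.Product using (_×_; _,_; ∃-syntax; proj₁; proj₂; map₂; uncurry)
open import Data.Product.Properties using (≡-dec)
open import Data.Sum using (_⊎_; inj₁; inj₂)
open import Data.Empty using (⊥; ⊥-elim)
open import Data.List
  using (List; []; _∷_; [_]; _++_; map; length; filter; allFin; upTo; cartesianProduct; concatMap; deduplicate)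
import Data.List.Properties as Listₚ
open import Data.List.Relation.Unary.All as All using (All; []; _∷_)
open import Data.List.Relation.Unary.AllPairs using ([]; _∷_)
open import Data.List.Relation.Unary.Any as Any using (Any; here; there; index)
open import Data.List.Relation.Unary.Unique.Propositional using (Unique)
import Data.List.Relation.Unary.Unique.Propositional.Properties as Uniqueₚ
import Data.List.Relation.Unary.Unique.DecPropositional.Properties as DecUniqueₚ
open import Data.List.Membership.Propositional using (_∈_; _∉_; _─_; find; lose)
open import Data.List.Membership.Propositional.Properties
  using ( ∈-map⁺; ∈-map⁻; ∈-filter⁺; ∈-filter⁻; ∈-allFin; ∈-upTo⁺; ∈-upTo⁻
        ; ∈-cartesianProduct⁺; ∈-cartesianProduct⁻; ∈-concatMap⁺; ∈-deduplicate⁺; ∈-deduplicate⁻; ∈-++⁻)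
open import Data.List.Relation.Binary.Subset.Propositional using (_⊆_)
open import Data.List.Relation.Binary.Permutation.Propositional using (_↭_; ↭-sym; ↭⇒↭ₛ)
open import Data.List.Relation.Binary.Permutation.Propositional.Properties using (∈-resp-↭)
import Data.List.Relation.Binary.Permutation.Propositional.Properties as Permₚ
open import Function using (_∘_; id)
open import Function.Bundles using (mk⇔)
open import Relation.Binary.PropositionalEquality hiding ([_])
import Data.List.Relation.Binary.Permutation.Setoid.Properties (setoid Cell) as SetoidPermₚ
open import Relation.Nullary using (¬_; Dec; yes; no; ¬?)
open import Relation.Unary using (Pred; Decidable)

-- Cells, rotations and directions

⊕-comm : ∀ a b → a ⊕ b ≡ b ⊕ a
⊕-comm (x , y) (u , v) = cong₂ _,_ (ℤₚ.+-comm x u) (ℤₚ.+-comm y v)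

⊕-assoc : ∀ a b c → (a ⊕ b) ⊕ c ≡ a ⊕ (b ⊕ c)
⊕-assoc (x , y) (u , v) (p , q) = cong₂ _,_ (ℤₚ.+-assoc x u p) (ℤₚ.+-assoc y v q)

⊕-identityʳ : ∀ a → a ⊕ (+ 0 , + 0) ≡ a
⊕-identityʳ (x , y) = cong₂ _,_ (ℤₚ.+-identityʳ x) (ℤₚ.+-identityʳ y)

⊖_ : Cell → Cell
⊖ (x , y) = (ℤ.- x , ℤ.- y)

⊕-⊖-cancel : ∀ a b → (a ⊕ b) ⊕ ⊖ b ≡ a
⊕-⊖-cancel (x , y) (u , v) = cong₂ _,_ (cancel x u) (cancel y v)
  where
  cancel : ∀ x u → (x ℤ.+ u) ℤ.+ ℤ.- u ≡ x
  cancel = ℤ-solve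

⊖-inverseˡ : ∀ a → ⊖ a ⊕ a ≡ (+ 0 , + 0)
⊖-inverseˡ (x , y) = cong₂ _,_ (ℤₚ.+-inverseˡ x) (ℤₚ.+-inverseˡ y)

⊕-cancelʳ : ∀ t {a b} → a ⊕ t ≡ b ⊕ t → a ≡ b
⊕-cancelʳ t {a} {b} e = begin
  a               ≡⟨ ⊕-⊖-cancel a t ⟨
  (a ⊕ t) ⊕ ⊖ t   ≡⟨ cong (_⊕ ⊖ t) e ⟩
  (b ⊕ t) ⊕ ⊖ t   ≡⟨ ⊕-⊖-cancel b t ⟩
  b               ∎
  where open ≡-Reasoning

⊕-cancelˡ : ∀ t {a b} → t ⊕ a ≡ t ⊕ b → a ≡ b
⊕-cancelˡ t {a} {b} e = ⊕-cancelʳ t (trans (⊕-comm a t) (trans e (⊕-comm t b)))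

-- The linear part of the affine map rot90: how rotations act on displacements.
rot90ᵥ : Cell → Cell
rot90ᵥ (x , y) = (ℤ.- y , x)

rotNᵥ : ℕ → Cell → Cell
rotNᵥ zero c = c
rotNᵥ (suc n) c = rot90ᵥ (rotNᵥ n c)

rot90-⊕ : ∀ a b → rot90 (a ⊕ b) ≡ rot90 a ⊕ rot90ᵥ b
rot90-⊕ (x , y) (u , v) = cong₂ _,_ (linear y v) refl
  where
  linear : ∀ y v → ℤ.- (y ℤ.+ v) ℤ.+ ℤ.- (+ 1) ≡ (ℤ.- y ℤ.+ ℤ.- (+ 1)) ℤ.+ ℤ.- v
  linear = ℤ-solve

rotN-⊕ : ∀ n a b → rotN n (a ⊕ b) ≡ rotN n a ⊕ rotNᵥ n b
rotN-⊕ zero a b = refl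
rotN-⊕ (suc n) a b = trans (cong rot90 (rotN-⊕ n a b)) (rot90-⊕ (rotN n a) (rotNᵥ n b))

move-⊕ : ∀ r t a b → move r t (a ⊕ b) ≡ move r t a ⊕ rotNᵥ (toℕ r) b
move-⊕ r t a b = begin
  rotate r (a ⊕ b) ⊕ t        ≡⟨ cong (_⊕ t) (rotN-⊕ (toℕ r) a b) ⟩
  (rotate r a ⊕ δ) ⊕ t        ≡⟨ ⊕-assoc (rotate r a) δ t ⟩
  rotate r a ⊕ (δ ⊕ t)        ≡⟨ cong (rotate r a ⊕_) (⊕-comm δ t) ⟩
  rotate r a ⊕ (t ⊕ δ)        ≡⟨ ⊕-assoc (rotate r a) t δ ⟨
  move r t a ⊕ δ              ∎
  where
  open ≡-Reasoning
  δ = rotNᵥ (toℕ r) b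

rot90-affine : ∀ a → rot90 a ≡ rot90ᵥ a ⊕ (ℤ.- (+ 1) , + 0)
rot90-affine (x , y) = cong₂ _,_ refl (sym (ℤₚ.+-identityʳ x))

rot90ᵥ-injective : ∀ {a b} → rot90ᵥ a ≡ rot90ᵥ b → a ≡ b
rot90ᵥ-injective e = cong₂ _,_ (cong proj₂ e) (ℤₚ.neg-injective (cong proj₁ e))

rot90-injective : ∀ {a b} → rot90 a ≡ rot90 b → a ≡ b
rot90-injective {a} {b} e =
  rot90ᵥ-injective (⊕-cancelʳ _ (trans (sym (rot90-affine a)) (trans e (rot90-affine b))))

rotN-injective : ∀ n {a b} → rotN n a ≡ rotN n b → a ≡ b
rotN-injective zero e = e
rotN-injective (suc n) e = rotN-injective n (rot90-injective e)

move-injective : ∀ r t {a b} → move r t a ≡ move r t b → a ≡ b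
move-injective r t e = rotN-injective (toℕ r) (⊕-cancelʳ t e)

∈-copy⁻ : ∀ r t {P x} → move r t x ∈ copy r t P → x ∈ P
∈-copy⁻ r t x∈ with _ , y∈P , e ← ∈-map⁻ (move r t) x∈ = subst (_∈ _) (sym (move-injective r t e)) y∈P

move-onto : ∀ r a x → move r (x ⊕ ⊖ rotate r a) a ≡ x
move-onto r a x = begin
  rotate r a ⊕ (x ⊕ ⊖ rotate r a)   ≡⟨ ⊕-comm (rotate r a) _ ⟩
  (x ⊕ ⊖ rotate r a) ⊕ rotate r a   ≡⟨ ⊕-assoc x _ _ ⟩
  x ⊕ (⊖ rotate r a ⊕ rotate r a)   ≡⟨ cong (x ⊕_) (⊖-inverseˡ (rotate r a)) ⟩
  x ⊕ (+ 0 , + 0)                   ≡⟨ ⊕-identityʳ x ⟩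
  x                                 ∎
  where open ≡-Reasoning

dir : Fin 4 → Cell
dir zero = (+ 1 , + 0)
dir (suc zero) = (+ 0 , + 1)
dir (suc (suc zero)) = (-[1+ 0 ] , + 0)
dir (suc (suc (suc zero))) = (+ 0 , -[1+ 0 ])

turn : Fin 4 → Fin 4
turn zero = suc zero
turn (suc zero) = suc (suc zero)
turn (suc (suc zero)) = suc (suc (suc zero))
turn (suc (suc (suc zero))) = zero

turnN : ℕ → Fin 4 → Fin 4
turnN zero d = d
turnN (suc n) d = turn (turnN n d)

turnN-+ : ∀ m n d → turnN (m + n) d ≡ turnN m (turnN n d)
turnN-+ zero n d = refl
turnN-+ (suc m) n d = cong turn (turnN-+ m n d)

turnN-4 : ∀ d → turnN 4 d ≡ d
turnN-4 zero = refl
turnN-4 (suc zero) = refl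
turnN-4 (suc (suc zero)) = refl
turnN-4 (suc (suc (suc zero))) = refl

turnN-*4 : ∀ n d → turnN (n * 4) d ≡ d
turnN-*4 zero d = refl
turnN-*4 (suc n) d = trans (turnN-+ 4 (n * 4) d) (trans (turnN-4 _) (turnN-*4 n d))

-- Four quarter turns are the identity, so turnN (n * 3) inverts turnN n.
turnN-inverseˡ : ∀ n d → turnN n (turnN (n * 3) d) ≡ d
turnN-inverseˡ n d = begin
  turnN n (turnN (n * 3) d)   ≡⟨ turnN-+ n (n * 3) d ⟨
  turnN (n + n * 3) d         ≡⟨ cong (λ m → turnN m d) (ℕₚ.*-suc n 3) ⟨
  turnN (n * 4) d             ≡⟨ turnN-*4 n d ⟩
  d                           ∎
  where open ≡-Reasoning

turnN-inverseʳ : ∀ n d → turnN (n * 3) (turnN n d) ≡ d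
turnN-inverseʳ n d = begin
  turnN (n * 3) (turnN n d)   ≡⟨ turnN-+ (n * 3) n d ⟨
  turnN (n * 3 + n) d         ≡⟨ cong (λ m → turnN m d) (trans (ℕₚ.+-comm (n * 3) n) (sym (ℕₚ.*-suc n 3))) ⟩
  turnN (n * 4) d             ≡⟨ turnN-*4 n d ⟩
  d                           ∎
  where open ≡-Reasoning

turnN-injective : ∀ n {a b} → turnN n a ≡ turnN n b → a ≡ b
turnN-injective n {a} {b} e =
  trans (sym (turnN-inverseʳ n a)) (trans (cong (turnN (n * 3)) e) (turnN-inverseʳ n b))

rot90ᵥ-dir : ∀ d → rot90ᵥ (dir d) ≡ dir (turn d)
rot90ᵥ-dir zero = refl
rot90ᵥ-dir (suc zero) = refl
rot90ᵥ-dir (suc (suc zero)) = refl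
rot90ᵥ-dir (suc (suc (suc zero))) = refl

rotNᵥ-dir : ∀ n d → rotNᵥ n (dir d) ≡ dir (turnN n d)
rotNᵥ-dir zero d = refl
rotNᵥ-dir (suc n) d = trans (cong rot90ᵥ (rotNᵥ-dir n d)) (rot90ᵥ-dir (turnN n d))

move-⊕-dir : ∀ r t a d → move r t (a ⊕ dir d) ≡ move r t a ⊕ dir (turnN (toℕ r) d)
move-⊕-dir r t a d = trans (move-⊕ r t a (dir d)) (cong (move r t a ⊕_) (rotNᵥ-dir (toℕ r) d))

dir-turn2 : ∀ d → dir d ⊕ dir (turnN 2 d) ≡ (+ 0 , + 0)
dir-turn2 zero = refl
dir-turn2 (suc zero) = refl
dir-turn2 (suc (suc zero)) = refl
dir-turn2 (suc (suc (suc zero))) = refl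

step-back : ∀ c d → (c ⊕ dir d) ⊕ dir (turnN 2 d) ≡ c
step-back c d = trans (⊕-assoc c _ _) (trans (cong (c ⊕_) (dir-turn2 d)) (⊕-identityʳ c))

adjacent⇒step : ∀ {c e} → Adjacent c e → ∃[ d ] e ≡ c ⊕ dir d
adjacent⇒step (inj₁ e) = zero , e
adjacent⇒step (inj₂ (inj₁ e)) = suc (suc zero) , e
adjacent⇒step (inj₂ (inj₂ (inj₁ e))) = suc zero , e
adjacent⇒step (inj₂ (inj₂ (inj₂ e))) = suc (suc (suc zero)) , e

turn≢ : ∀ d → turn d ≢ d
turn≢ zero ()
turn≢ (suc zero) ()
turn≢ (suc (suc zero)) ()
turn≢ (suc (suc (suc zero))) ()

half-turn≢ : ∀ d → turn (turn d) ≢ d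
half-turn≢ zero ()
half-turn≢ (suc zero) ()
half-turn≢ (suc (suc zero)) ()
half-turn≢ (suc (suc (suc zero))) ()

another-direction : ∀ (a b : Fin 4) → ∃[ d ] d ≢ a × d ≢ b
another-direction a b with turn a Finₚ.≟ b
... | no turn-a≢b = turn a , turn≢ a , turn-a≢b
... | yes refl = turn (turn a) , half-turn≢ a , turn≢ (turn a)

-- Counting in lists

module _ {A : Set} where

  ∈-─ : ∀ {x z : A} {ys} (p : x ∈ ys) → z ∈ ys → z ≢ x → z ∈ ys ─ p
  ∈-─ (here refl) (here refl) z≢x = ⊥-elim (z≢x refl)
  ∈-─ (here refl) (there q) _ = q
  ∈-─ (there p) (here refl) _ = here refl
  ∈-─ (there p) (there q) z≢x = there (∈-─ p q z≢x)

  Unique⇒length≤ : ∀ {xs ys : List A} → Unique xs → xs ⊆ ys → length xs ≤ length ys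
  Unique⇒length≤ {[]} _ _ = z≤n
  Unique⇒length≤ {x ∷ xs} {ys} (x∉xs ∷ uxs) xs⊆ys = begin
    suc (length xs)                   ≤⟨ s≤s (Unique⇒length≤ uxs xs⊆ys─x) ⟩
    suc (length (ys ─ x∈ys))          ≡⟨ Listₚ.length-removeAt′ ys (index x∈ys) ⟨
    length ys                         ∎
    where
    open ℕₚ.≤-Reasoning
    x∈ys = xs⊆ys (here refl)
    xs⊆ys─x : xs ⊆ ys ─ x∈ys
    xs⊆ys─x z∈xs = ∈-─ x∈ys (xs⊆ys (there z∈xs)) (λ z≡x → All.lookup x∉xs z∈xs (sym z≡x))

  length-filter-split : ∀ {ℓ} {P : Pred A ℓ} (P? : Decidable P) xs →
                        length (filter P? xs) + length (filter (¬? ∘ P?) xs) ≡ length xs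
  length-filter-split P? [] = refl
  length-filter-split P? (x ∷ xs) with P? x
  ... | yes _ = cong suc (length-filter-split P? xs)
  ... | no _ = trans (ℕₚ.+-suc _ _) (cong suc (length-filter-split P? xs))

  single-value : A → ∀ xs → length xs ≤ 1 → ∃[ m ] (∀ {y} → y ∈ xs → y ≡ m)
  single-value a [] _ = a , λ ()
  single-value _ (m ∷ []) _ = m , λ { (here y≡m) → y≡m }
  single-value _ (_ ∷ _ ∷ _) (s≤s ())

  sum-map-mono : ∀ {f g : A → ℕ} xs → (∀ {x} → x ∈ xs → f x ≤ g x) → sum (map f xs) ≤ sum (map g xs)
  sum-map-mono [] _ = z≤n
  sum-map-mono (x ∷ xs) f≤g = ℕₚ.+-mono-≤ (f≤g (here refl)) (sum-map-mono xs (f≤g ∘ there))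

  sum-map-strict : ∀ {f g : A → ℕ} xs → (∀ {x} → x ∈ xs → f x ≤ g x) →
                   Any (λ x → f x < g x) xs → sum (map f xs) < sum (map g xs)
  sum-map-strict (x ∷ xs) f≤g (here fx<gx) = ℕₚ.+-mono-<-≤ fx<gx (sum-map-mono xs (f≤g ∘ there))
  sum-map-strict (x ∷ xs) f≤g (there any) = ℕₚ.+-mono-≤-< (f≤g (here refl)) (sum-map-strict xs (f≤g ∘ there) any)

  sum+count≤1 : ∀ (h : A → ℕ) xs → (∀ {x} → x ∈ xs → h x ≤ 2) →
                sum (map h xs) + length (filter (λ x → h x ≤? 1) xs) ≤ 2 * length xs
  sum+count≤1 h [] _ = z≤n
  sum+count≤1 h (x ∷ xs) h≤2 with h x ≤? 1 | sum+count≤1 h xs (h≤2 ∘ there)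
  ... | yes hx≤1 | ih = begin
    h x + S + length (filter low? (x ∷ xs))   ≡⟨ cong (λ l → h x + S + length l) (Listₚ.filter-accept low? hx≤1) ⟩
    h x + S + suc F                           ≡⟨ shuffle (h x) S F ⟩
    (h x + 1) + (S + F)                       ≤⟨ ℕₚ.+-mono-≤ (ℕₚ.+-monoˡ-≤ 1 hx≤1) ih ⟩
    2 + 2 * length xs                         ≡⟨ ℕₚ.*-suc 2 (length xs) ⟨
    2 * suc (length xs)                       ∎
    where
    open ℕₚ.≤-Reasoning
    low? = λ x → h x ≤? 1
    S = sum (map h xs)
    F = length (filter low? xs)
    shuffle : ∀ a b c → a + b + suc c ≡ (a + 1) + (b + c)
    shuffle = ℕ-solve
  ... | no hx≰1 | ih = begin
    h x + S + length (filter low? (x ∷ xs))   ≡⟨ cong (λ l → h x + S + length l) (Listₚ.filter-reject low? hx≰1) ⟩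
    h x + S + F                               ≡⟨ ℕₚ.+-assoc (h x) S F ⟩
    h x + (S + F)                             ≤⟨ ℕₚ.+-mono-≤ (h≤2 (here refl)) ih ⟩
    2 + 2 * length xs                         ≡⟨ ℕₚ.*-suc 2 (length xs) ⟨
    2 * suc (length xs)                       ∎
    where
    open ℕₚ.≤-Reasoning
    low? = λ x → h x ≤? 1
    S = sum (map h xs)
    F = length (filter low? xs)

module _ {A B : Set} where

  length-cartesianProduct : ∀ (xs : List A) (ys : List B) →
                            length (cartesianProduct xs ys) ≡ length xs * length ys
  length-cartesianProduct [] ys = refl
  length-cartesianProduct (x ∷ xs) ys =
    trans (Listₚ.length-++ (map (x ,_) ys))
          (cong₂ _+_ (Listₚ.length-map (x ,_) ys) (length-cartesianProduct xs ys))

  length-concatMap≤ : ∀ (g : A → List B) xs {c} → (∀ {x} → x ∈ xs → length (g x) ≤ c) →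
                      length (concatMap g xs) ≤ c * length xs
  length-concatMap≤ g [] _ = z≤n
  length-concatMap≤ g (x ∷ xs) {c} g≤c = begin
    length (g x ++ concatMap g xs)        ≡⟨ Listₚ.length-++ (g x) ⟩
    length (g x) + length (concatMap g xs) ≤⟨ ℕₚ.+-mono-≤ (g≤c (here refl)) (length-concatMap≤ g xs (g≤c ∘ there)) ⟩
    c + c * length xs                     ≡⟨ ℕₚ.*-suc c (length xs) ⟨
    c * suc (length xs)                   ∎
    where open ℕₚ.≤-Reasoning

  Unique-map-on : ∀ (g : A → B) {xs} → Unique xs →
                  (∀ {x y} → x ∈ xs → y ∈ xs → g x ≡ g y → x ≡ y) → Unique (map g xs)
  Unique-map-on g [] _ = []
  Unique-map-on g {x ∷ xs} (x∉xs ∷ uxs) injective =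
    All.tabulate fresh ∷ Unique-map-on g uxs (λ x∈ y∈ → injective (there x∈) (there y∈))
    where
    fresh : ∀ {z} → z ∈ map g xs → g x ≢ z
    fresh z∈ gx≡z with y , y∈xs , refl ← ∈-map⁻ g z∈ =
      All.lookup x∉xs y∈xs (injective (here refl) (there y∈xs) gx≡z)

-- Degrees, ends and T-tetrominoes

Surrounded : List Cell → Cell → Fin 4 → Set
Surrounded P x m = ∀ d → d ≢ m → x ⊕ dir d ∈ P

Surrounded-mono : ∀ {P Q x m} → P ⊆ Q → Surrounded P x m → Surrounded Q x m
Surrounded-mono P⊆Q s d d≢m = P⊆Q (s d d≢m)

copy-step : ∀ r t {P x d} → x ⊕ dir d ∈ P → move r t x ⊕ dir (turnN (toℕ r) d) ∈ copy r t P
copy-step r t {P} {x} {d} x⊕d∈P = subst (_∈ copy r t P) (move-⊕-dir r t x d) (∈-map⁺ (move r t) x⊕d∈P)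

neighbour-copy : ∀ r t {P x d} → x ⊕ dir (turnN (toℕ r * 3) d) ∈ P → move r t x ⊕ dir d ∈ copy r t P
neighbour-copy r t {P} {x} {d} x⊕d′∈P =
  subst (λ e → move r t x ⊕ dir e ∈ copy r t P) (turnN-inverseˡ (toℕ r) d) (copy-step r t x⊕d′∈P)

Surrounded-copy : ∀ r t {P x m} → Surrounded P x m → Surrounded (copy r t P) (move r t x) (turnN (toℕ r) m)
Surrounded-copy r t {m = m} s d d≢rm = neighbour-copy r t (s _ d′≢m)
  where
  d′≢m : turnN (toℕ r * 3) d ≢ m
  d′≢m e = d≢rm (trans (sym (turnN-inverseˡ (toℕ r) d)) (cong (turnN (toℕ r)) e))

-- The T-tetromino is its hub (1,0) with the arms west, east and north; the
-- rotation turn m sends the missing southern arm to m.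
T-at : ∀ {P x m} → x ∈ P → Surrounded P x m → ContainsCopy T-tetromino P
T-at {P} {x} {m} x∈P s = r , t , arm (suc (suc zero)) (λ ()) ∷ hub∈P ∷ arm zero (λ ()) ∷ arm (suc zero) (λ ()) ∷ []
  where
  r = turn m
  hub = (+ 1 , + 0)
  t = x ⊕ ⊖ rotate r hub
  hub∈P : move r t hub ∈ P
  hub∈P = subst (_∈ P) (sym (move-onto r hub x)) x∈P
  south↦m : ∀ m → turnN (toℕ (turn m)) (suc (suc (suc zero))) ≡ m
  south↦m zero = refl
  south↦m (suc zero) = refl
  south↦m (suc (suc zero)) = refl
  south↦m (suc (suc (suc zero))) = refl
  arm : ∀ k → k ≢ suc (suc (suc zero)) → move r t (hub ⊕ dir k) ∈ P
  arm k k≢south = subst (_∈ P) (sym (trans (move-⊕-dir r t hub k) (cong (_⊕ dir d) (move-onto r hub x))))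
    (s d (λ e → k≢south (turnN-injective (toℕ r) (trans e (sym (south↦m m))))))
    where d = turnN (toℕ r) k

_≟ᶜ_ : (a b : Cell) → Dec (a ≡ b)
_≟ᶜ_ = ≡-dec ℤ._≟_ ℤ._≟_

open import Data.List.Membership.DecPropositional _≟ᶜ_ using (_∈?_)

nbrDirs : List Cell → Cell → List (Fin 4)
nbrDirs P x = filter (λ d → x ⊕ dir d ∈? P) (allFin 4)

degree : List Cell → Cell → ℕ
degree P x = length (nbrDirs P x)

nbrDirs-unique : ∀ P x → Unique (nbrDirs P x)
nbrDirs-unique P x = Uniqueₚ.filter⁺ (λ d → x ⊕ dir d ∈? P) (Uniqueₚ.allFin⁺ 4)

∈-nbrDirs⁺ : ∀ P x {d} → x ⊕ dir d ∈ P → d ∈ nbrDirs P x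
∈-nbrDirs⁺ P x {d} = ∈-filter⁺ (λ d → x ⊕ dir d ∈? P) (∈-allFin d)

∈-nbrDirs⁻ : ∀ P x {d} → d ∈ nbrDirs P x → x ⊕ dir d ∈ P
∈-nbrDirs⁻ P x d∈ = proj₂ (∈-filter⁻ (λ d → x ⊕ dir d ∈? P) d∈)

degree-mono : ∀ {P Q} x → P ⊆ Q → degree P x ≤ degree Q x
degree-mono {P} {Q} x P⊆Q = Unique⇒length≤ (nbrDirs-unique P x) (∈-nbrDirs⁺ Q x ∘ P⊆Q ∘ ∈-nbrDirs⁻ P x)

degree-grow : ∀ {P Q x d} → P ⊆ Q → x ⊕ dir d ∉ P → x ⊕ dir d ∈ Q → suc (degree P x) ≤ degree Q x
degree-grow {P} {Q} {x} {d} P⊆Q ∉P ∈Q = Unique⇒length≤ (new ∷ nbrDirs-unique P x) ⊆Q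
  where
  new : All (d ≢_) (nbrDirs P x)
  new = All.tabulate λ { e∈ refl → ∉P (∈-nbrDirs⁻ P x e∈) }
  ⊆Q : d ∷ nbrDirs P x ⊆ nbrDirs Q x
  ⊆Q (here refl) = ∈-nbrDirs⁺ Q x ∈Q
  ⊆Q (there e∈) = ∈-nbrDirs⁺ Q x (P⊆Q (∈-nbrDirs⁻ P x e∈))

degree-pos : ∀ P x {d} → x ⊕ dir d ∈ P → 1 ≤ degree P x
degree-pos P x {d} x⊕d∈P = Unique⇒length≤ {xs = [ d ]} ([] ∷ []) λ { (here refl) → ∈-nbrDirs⁺ P x x⊕d∈P }

degree≤1 : ∀ {P x m} → (∀ d → x ⊕ dir d ∈ P → d ≡ m) → degree P x ≤ 1
degree≤1 {P} {x} {m} only-m =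
  Unique⇒length≤ {ys = [ m ]} (nbrDirs-unique P x) (λ d∈ → here (only-m _ (∈-nbrDirs⁻ P x d∈)))

surrounded-of-degree≥3 : ∀ {P x} → 3 ≤ degree P x → ∃[ m ] Surrounded P x m
surrounded-of-degree≥3 {P} {x} 3≤deg = m , surrounded
  where
  present? = λ d → x ⊕ dir d ∈? P
  absent = filter (¬? ∘ present?) (allFin 4)
  absent≤1 : length absent ≤ 1
  absent≤1 = ℕₚ.+-cancelˡ-≤ 3 _ _ (ℕₚ.≤-trans (ℕₚ.+-monoˡ-≤ _ 3≤deg)
               (ℕₚ.≤-reflexive (length-filter-split present? (allFin 4))))
  m = proj₁ (single-value zero absent absent≤1)
  only-m = proj₂ (single-value zero absent absent≤1)
  surrounded : Surrounded P x m
  surrounded d d≢m with present? d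
  ... | yes x⊕d∈P = x⊕d∈P
  ... | no x⊕d∉P = ⊥-elim (d≢m (only-m (∈-filter⁺ (¬? ∘ present?) (∈-allFin d) x⊕d∉P)))

degree≤2 : ∀ {P x} → ¬ ContainsCopy T-tetromino P → x ∈ P → degree P x ≤ 2
degree≤2 {P} {x} T-free x∈P with degree P x ≤? 2
... | yes deg≤2 = deg≤2
... | no deg≰2 = ⊥-elim (T-free (T-at x∈P (proj₂ (surrounded-of-degree≥3 {P} {x} (ℕₚ.≰⇒> deg≰2)))))

-- Adding a cell next to a placed one raises the degree sum by at least 2.
handshake : ∀ L → Unique L → GoodOrder L → 2 * length L ≤ sum (map (degree L) L) + 2
handshake [] _ _ = z≤n
handshake (c ∷ []) _ _ = ℕₚ.m≤n+m 2 _
handshake (c ∷ L@(_ ∷ _)) (c∉L ∷ uL) (c-adj , ordered) = begin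
  2 * suc (length L)                                       ≡⟨ ℕₚ.*-suc 2 (length L) ⟩
  2 + 2 * length L                                         ≤⟨ ℕₚ.+-monoʳ-≤ 2 (handshake L uL ordered) ⟩
  2 + (sum (map (degree L) L) + 2)                         ≡⟨ ℕₚ.+-comm 2 _ ⟩
  (sum (map (degree L) L) + 2) + 2                         ≡⟨ cong (_+ 2) (ℕₚ.+-comm _ 2) ⟩
  suc (suc (sum (map (degree L) L))) + 2                   ≤⟨ ℕₚ.+-monoˡ-≤ 2 (ℕₚ.+-mono-≤ c-has-nbr others-grow) ⟩
  degree (c ∷ L) c + sum (map (degree (c ∷ L)) L) + 2      ∎
  where
  open ℕₚ.≤-Reasoning
  L⊆cL : L ⊆ c ∷ L
  L⊆cL = there
  c∉ : c ∉ L
  c∉ c∈L = All.lookup c∉L c∈L refl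
  steps : Any (λ y → ∃[ d ] y ≡ c ⊕ dir d) L
  steps = Any.map (adjacent⇒step {c}) c-adj
  c-has-nbr : 1 ≤ degree (c ∷ L) c
  c-has-nbr with _ , y∈L , d , refl ← find steps = degree-pos (c ∷ L) c {d} (there y∈L)
  grows : ∀ {y} → ∃[ d ] y ≡ c ⊕ dir d → degree L y < degree (c ∷ L) y
  grows (d , refl) = degree-grow {x = c ⊕ dir d} {d = turnN 2 d} L⊆cL (subst (_∉ L) (sym (step-back c d)) c∉)
                                      (subst (_∈ c ∷ L) (sym (step-back c d)) (here refl))
  others-grow : suc (sum (map (degree L) L)) ≤ sum (map (degree (c ∷ L)) L)
  others-grow = sum-map-strict L (λ {x} _ → degree-mono x L⊆cL) (Any.map grows steps)

ends : List Cell → List Cell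
ends P = filter (λ x → degree P x ≤? 1) P

∈-ends⁺ : ∀ {P x m} → x ∈ P → (∀ d → x ⊕ dir d ∈ P → d ≡ m) → x ∈ ends P
∈-ends⁺ {P} {x} {m} x∈P only-m = ∈-filter⁺ (λ x → degree P x ≤? 1) x∈P (degree≤1 {P} {x} {m} only-m)

∈-copy-ends⁺ : ∀ r t {P x m} → x ∈ copy r t P → (∀ d → x ⊕ dir d ∈ copy r t P → d ≡ m) →
               x ∈ copy r t (ends P)
∈-copy-ends⁺ r t {P} {m = m} x∈ only-m with y , y∈P , refl ← ∈-map⁻ (move r t) x∈ =
  ∈-map⁺ (move r t) (∈-ends⁺ {m = turnN (toℕ r * 3) m} y∈P only-m′)
  where
  only-m′ : ∀ d → y ⊕ dir d ∈ P → d ≡ turnN (toℕ r * 3) m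
  only-m′ d y⊕d∈P = trans (sym (turnN-inverseʳ (toℕ r) d)) (cong (turnN (toℕ r * 3)) (only-m _ (copy-step r t y⊕d∈P)))

length-ends≤2 : ∀ {L} → Unique L → GoodOrder L → ¬ ContainsCopy T-tetromino L → length (ends L) ≤ 2
length-ends≤2 {L} unique ordered T-free = ℕₚ.+-cancelˡ-≤ (sum (map (degree L) L)) _ _
  (ℕₚ.≤-trans (sum+count≤1 (degree L) L (degree≤2 T-free)) (handshake L unique ordered))

has-neighbour : ∀ {L a b} → GoodOrder L → a ∈ L → b ∈ L → a ≢ b → ∀ {x} → x ∈ L → ∃[ d ] x ⊕ dir d ∈ L
has-neighbour {_ ∷ []} _ (here refl) (here refl) a≢b = ⊥-elim (a≢b refl)
has-neighbour {_ ∷ _ ∷ _} ordered _ _ _ = long ordered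
  where
  long : ∀ {c y L} → GoodOrder (c ∷ y ∷ L) → ∀ {x} → x ∈ c ∷ y ∷ L → ∃[ d ] x ⊕ dir d ∈ c ∷ y ∷ L
  long {c} (c-adj , _) (here refl) with _ , y∈ , d , refl ← find (Any.map (adjacent⇒step {c}) c-adj) =
    d , there y∈
  long {c} {L = []} (c-adj , _) (there (here refl))
    with _ , here refl , d , refl ← find (Any.map (adjacent⇒step {c}) c-adj) = turnN 2 d , here (step-back c d)
  long {L = _ ∷ _} (_ , ordered) (there x∈) = map₂ there (long ordered x∈)

-- U-turns and snake tiles

-- The notch of a U-turn is the missing middle square of its long side; in
-- U-pentomino it is (1,1), open to the north.
notch : ∀ {P} → UTurn P → Cell
notch ((r , t) , _) = move r t (+ 1 , + 1)

opening : ∀ {P} → UTurn P → Fin 4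
opening ((r , _) , _) = turnN (toℕ r) (suc zero)

opening-injective : ∀ {r r′ : Fin 4} → turnN (toℕ r) (suc zero) ≡ turnN (toℕ r′) (suc zero) → r ≡ r′
opening-injective {r} {r′} e = turnN-injective 1 (trans (sym (opening≡turn r)) (trans e (opening≡turn r′)))
  where
  opening≡turn : ∀ r → turnN (toℕ r) (suc zero) ≡ turn r
  opening≡turn zero = refl
  opening≡turn (suc zero) = refl
  opening≡turn (suc (suc zero)) = refl
  opening≡turn (suc (suc (suc zero))) = refl

U-notch-surrounded : Surrounded U-pentomino (+ 1 , + 1) (suc zero)
U-notch-surrounded zero _ = there (there (there (there (here refl))))
U-notch-surrounded (suc zero) north≢north = ⊥-elim (north≢north refl)
U-notch-surrounded (suc (suc zero)) _ = there (there (there (here refl)))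
U-notch-surrounded (suc (suc (suc zero))) _ = there (here refl)

notch-surrounded : ∀ {P} (u : UTurn P) → Surrounded P (notch u) (opening u)
notch-surrounded {P} ((r , t) , U⊆P) =
  Surrounded-mono {Q = P} {x = move r t (+ 1 , + 1)} (All.lookup U⊆P)
                  (Surrounded-copy r t {U-pentomino} {+ 1 , + 1} U-notch-surrounded)

notch∉ : ∀ {P} → ¬ ContainsCopy T-tetromino P → (u : UTurn P) → notch u ∉ P
notch∉ T-free u notch∈P = T-free (T-at notch∈P (notch-surrounded u))

shared-notch : ∀ {P} (u v : UTurn P) → notch u ≡ notch v →
               proj₁ u ≡ proj₁ v ⊎ (∀ d → notch u ⊕ dir d ∈ P)
shared-notch u@((r , t) , _) v@((r′ , t′) , _) e with opening u Finₚ.≟ opening v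
... | yes same with refl ← opening-injective {r} {r′} same =
  inj₁ (cong (r ,_) (⊕-cancelˡ (rotate r (+ 1 , + 1)) e))
... | no differ = inj₂ all-sides
  where
  all-sides : ∀ d → notch u ⊕ dir d ∈ _
  all-sides d with d Finₚ.≟ opening u
  ... | no d≢u = notch-surrounded u d d≢u
  ... | yes refl = subst (λ n → n ⊕ dir d ∈ _) (sym e) (notch-surrounded v d differ)

record SnakeTile (L : List Cell) : Set where
  field
    unique : Unique L
    ordered : GoodOrder L
    T-free : ¬ ContainsCopy T-tetromino L
    uturn : Fin 3 → UTurn L
    uturn-injective : ∀ {j j′} → proj₁ (uturn j) ≡ proj₁ (uturn j′) → j ≡ j′

snake-has-neighbour : ∀ {L} → SnakeTile L → ∀ {x} → x ∈ L → ∃[ d ] x ⊕ dir d ∈ L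
snake-has-neighbour tile with (r , t) , (c₀ ∷ c₁ ∷ _) ← SnakeTile.uturn tile zero =
  has-neighbour (SnakeTile.ordered tile) c₀ c₁ (λ e → distinct (move-injective r t e))
  where
  distinct : (+ 0 , + 0) ≢ (+ 1 , + 0)
  distinct ()

ContainsCopy-mono : ∀ {S P Q} → P ⊆ Q → ContainsCopy S P → ContainsCopy S Q
ContainsCopy-mono P⊆Q (r , t , S⊆P) = r , t , All.map P⊆Q S⊆P

UTurn-mono : ∀ {P Q} → P ⊆ Q → UTurn P → UTurn Q
UTurn-mono P⊆Q (position , U⊆P) = position , All.map P⊆Q U⊆P

same-position⇒SameSet : ∀ {P} (u v : UTurn P) → proj₁ u ≡ proj₁ v → SameSet (uCells u) (uCells v)
same-position⇒SameSet _ _ refl _ = mk⇔ id id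

spine : ∀ {P} → GoodSnake P → ∃[ L ] L ↭ P × SnakeTile L
spine {P} (unique-P , (L , L↭P , ordered) , (T-free , _) , u₀ , u₁ , u₂ , u₀≉u₁ , u₀≉u₂ , u₁≉u₂) =
  L , L↭P , record
    { unique = SetoidPermₚ.Unique-resp-↭ (↭⇒↭ₛ (↭-sym L↭P)) unique-P
    ; ordered = ordered
    ; T-free = T-free ∘ ContainsCopy-mono (∈-resp-↭ L↭P)
    ; uturn = uturn
    ; uturn-injective = uturn-injective
    }
  where
  uturnP : Fin 3 → UTurn P
  uturnP zero = u₀
  uturnP (suc zero) = u₁
  uturnP (suc (suc zero)) = u₂
  uturn : Fin 3 → UTurn L
  uturn = UTurn-mono (∈-resp-↭ (↭-sym L↭P)) ∘ uturnP
  uturn-injective : ∀ {j j′} → proj₁ (uturn j) ≡ proj₁ (uturn j′) → j ≡ j′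
  uturn-injective {zero} {zero} _ = refl
  uturn-injective {zero} {suc zero} e = ⊥-elim (u₀≉u₁ (same-position⇒SameSet u₀ u₁ e))
  uturn-injective {zero} {suc (suc zero)} e = ⊥-elim (u₀≉u₂ (same-position⇒SameSet u₀ u₂ e))
  uturn-injective {suc zero} {zero} e = ⊥-elim (u₀≉u₁ (same-position⇒SameSet u₀ u₁ (sym e)))
  uturn-injective {suc zero} {suc zero} _ = refl
  uturn-injective {suc zero} {suc (suc zero)} e = ⊥-elim (u₁≉u₂ (same-position⇒SameSet u₁ u₂ e))
  uturn-injective {suc (suc zero)} {zero} e = ⊥-elim (u₀≉u₂ (same-position⇒SameSet u₀ u₂ (sym e)))
  uturn-injective {suc (suc zero)} {suc zero} e = ⊥-elim (u₁≉u₂ (same-position⇒SameSet u₁ u₂ (sym e)))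
  uturn-injective {suc (suc zero)} {suc (suc zero)} _ = refl

-- Distances and squares

record Near (k : ℕ) (a b : Cell) : Set where
  constructor near
  field
    offset : Cell
    arrives : b ≡ a ⊕ offset
    horizontal : ℤ.∣ proj₁ offset ∣ ≤ k
    vertical : ℤ.∣ proj₂ offset ∣ ≤ k

Near-refl : ∀ {k} a → Near k a a
Near-refl a = near (+ 0 , + 0) (sym (⊕-identityʳ a)) z≤n z≤n

Near-sym : ∀ {k a b} → Near k a b → Near k b a
Near-sym {k} {a} (near (u , v) refl u≤k v≤k) =
  near (⊖ (u , v)) (sym (⊕-⊖-cancel a (u , v)))
       (subst (_≤ k) (sym (ℤₚ.∣-i∣≡∣i∣ u)) u≤k) (subst (_≤ k) (sym (ℤₚ.∣-i∣≡∣i∣ v)) v≤k)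

Near-trans : ∀ {k l a b c} → Near k a b → Near l b c → Near (k + l) a c
Near-trans {a = a} (near (u , v) refl u≤k v≤k) (near (u′ , v′) refl u′≤l v′≤l) =
  near (u ℤ.+ u′ , v ℤ.+ v′) (⊕-assoc a (u , v) (u′ , v′))
       (ℕₚ.≤-trans (ℤₚ.∣i+j∣≤∣i∣+∣j∣ u u′) (ℕₚ.+-mono-≤ u≤k u′≤l))
       (ℕₚ.≤-trans (ℤₚ.∣i+j∣≤∣i∣+∣j∣ v v′) (ℕₚ.+-mono-≤ v≤k v′≤l))

Near-mono : ∀ {k l a b} → k ≤ l → Near k a b → Near l a b
Near-mono k≤l (near δ e u≤k v≤k) = near δ e (ℕₚ.≤-trans u≤k k≤l) (ℕₚ.≤-trans v≤k k≤l)

Near-step : ∀ a d → Near 1 a (a ⊕ dir d)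
Near-step a zero = near (dir zero) refl (s≤s z≤n) z≤n
Near-step a (suc zero) = near (dir (suc zero)) refl z≤n (s≤s z≤n)
Near-step a (suc (suc zero)) = near (dir (suc (suc zero))) refl (s≤s z≤n) z≤n
Near-step a (suc (suc (suc zero))) = near (dir (suc (suc (suc zero)))) refl z≤n (s≤s z≤n)

Near-move : ∀ r t {k a b} → Near k a b → Near k (move r t a) (move r t b)
Near-move r t {k} {a} (near δ refl u≤k v≤k) = near (rotNᵥ (toℕ r) δ) (move-⊕ r t a δ) u′≤k v′≤k
  where
  bounded : ∀ n δ → ℤ.∣ proj₁ δ ∣ ≤ k → ℤ.∣ proj₂ δ ∣ ≤ k →
            ℤ.∣ proj₁ (rotNᵥ n δ) ∣ ≤ k × ℤ.∣ proj₂ (rotNᵥ n δ) ∣ ≤ k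
  bounded zero δ u≤k v≤k = u≤k , v≤k
  bounded (suc n) δ u≤k v≤k with u′≤k , v′≤k ← bounded n δ u≤k v≤k =
    subst (_≤ k) (sym (ℤₚ.∣-i∣≡∣i∣ (proj₂ (rotNᵥ n δ)))) v′≤k , u′≤k
  u′≤k = proj₁ (bounded (toℕ r) δ u≤k v≤k)
  v′≤k = proj₂ (bounded (toℕ r) δ u≤k v≤k)

Near-cons : ∀ c L → Any (Adjacent c) L →
            (∀ {x y} → x ∈ L → y ∈ L → Near (length L) x y) →
            ∀ {x y} → x ∈ c ∷ L → y ∈ c ∷ L → Near (suc (length L)) x y
Near-cons c L c-adj near-L = within
  where
  from-head : ∀ {y} → y ∈ L → Near (suc (length L)) c y
  from-head y∈L with _ , z∈L , d , refl ← find (Any.map (adjacent⇒step {c}) c-adj) =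
    Near-trans {1} {length L} (Near-step c d) (near-L z∈L y∈L)
  within : ∀ {x y} → x ∈ c ∷ L → y ∈ c ∷ L → Near (suc (length L)) x y
  within (here refl) (here refl) = Near-refl c
  within (here refl) (there y∈L) = from-head y∈L
  within (there x∈L) (here refl) = Near-sym (from-head x∈L)
  within (there x∈L) (there y∈L) = Near-mono {length L} (ℕₚ.n≤1+n _) (near-L x∈L y∈L)

GoodOrder⇒Near : ∀ L → GoodOrder L → ∀ {x y} → x ∈ L → y ∈ L → Near (length L) x y
GoodOrder⇒Near (c ∷ []) _ (here refl) (here refl) = Near-refl c
GoodOrder⇒Near (c ∷ L@(_ ∷ _)) (c-adj , ordered) = Near-cons c L c-adj (GoodOrder⇒Near L ordered)

copy-Near : ∀ r t {L} → GoodOrder L → ∀ {x y} → x ∈ copy r t L → y ∈ copy r t L → Near (length L) x y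
copy-Near r t {L} ordered x∈ y∈
  with x′ , x′∈ , refl ← ∈-map⁻ (move r t) x∈ | y′ , y′∈ , refl ← ∈-map⁻ (move r t) y∈ =
  Near-move r t (GoodOrder⇒Near L ordered x′∈ y′∈)

square : Cell → ℕ → List Cell
square o n = map (λ (a , b) → o ⊕ (+ a , + b)) (cartesianProduct (upTo n) (upTo n))

square-unique : ∀ o n → Unique (square o n)
square-unique o n = Uniqueₚ.map⁺ injective (Uniqueₚ.cartesianProduct⁺ (Uniqueₚ.upTo⁺ n) (Uniqueₚ.upTo⁺ n))
  where
  injective : ∀ {p q : ℕ × ℕ} → o ⊕ (+ proj₁ p , + proj₂ p) ≡ o ⊕ (+ proj₁ q , + proj₂ q) → p ≡ q
  injective e = let e′ = ⊕-cancelˡ o e in cong₂ _,_ (ℤₚ.+-injective (cong proj₁ e′)) (ℤₚ.+-injective (cong proj₂ e′))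

length-square : ∀ o n → length (square o n) ≡ n * n
length-square o n = begin
  length (square o n)                           ≡⟨ Listₚ.length-map _ (cartesianProduct (upTo n) (upTo n)) ⟩
  length (cartesianProduct (upTo n) (upTo n))   ≡⟨ length-cartesianProduct (upTo n) (upTo n) ⟩
  length (upTo n) * length (upTo n)             ≡⟨ cong₂ _*_ (Listₚ.length-upTo n) (Listₚ.length-upTo n) ⟩
  n * n                                         ∎
  where open ≡-Reasoning

shift-coordinate : ∀ {N K a} δ → a < N → ℤ.∣ δ ∣ ≤ K →
                   ∃[ a′ ] a′ < N + 2 * K × ℤ.- (+ K) ℤ.+ + a′ ≡ + a ℤ.+ δ
shift-coordinate {N} {K} {a} (+ u) a<N u≤K = K + (a + u) , bound , position
  where
  bound : K + (a + u) < N + 2 * K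
  bound = ℕₚ.<-≤-trans (ℕₚ.+-monoʳ-< K (ℕₚ.+-mono-<-≤ a<N u≤K)) (ℕₚ.≤-reflexive (rearrange K N))
    where
    rearrange : ∀ K N → K + (N + K) ≡ N + 2 * K
    rearrange = ℕ-solve
  position : ℤ.- (+ K) ℤ.+ + (K + (a + u)) ≡ + a ℤ.+ + u
  position = trans (cong (λ x → ℤ.- (+ K) ℤ.+ x) (trans (ℤₚ.pos-+ K (a + u)) (cong (λ x → + K ℤ.+ x) (ℤₚ.pos-+ a u))))
                   (cancel (+ K) (+ a ℤ.+ + u))
    where
    cancel : ∀ k x → ℤ.- k ℤ.+ (k ℤ.+ x) ≡ x
    cancel = ℤ-solve
shift-coordinate {N} {K} {a} -[1+ u ] a<N 1+u≤K = a + w , bound , position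
  where
  w = K ℕ.∸ suc u
  K≡1+u+w : K ≡ suc u + w
  K≡1+u+w = sym (ℕₚ.m+[n∸m]≡n 1+u≤K)
  bound : a + w < N + 2 * K
  bound = ℕₚ.<-≤-trans (ℕₚ.+-mono-<-≤ a<N (ℕₚ.m∸n≤m K (suc u))) (ℕₚ.+-monoʳ-≤ N (ℕₚ.m≤m+n K (1 * K)))
  position : ℤ.- (+ K) ℤ.+ + (a + w) ≡ + a ℤ.+ -[1+ u ]
  position = trans (cong₂ (λ k x → ℤ.- k ℤ.+ x) (trans (cong +_ K≡1+u+w) (ℤₚ.pos-+ (suc u) w)) (ℤₚ.pos-+ a w))
                   (cancel (+ suc u) (+ a) (+ w))
    where
    cancel : ∀ v x y → ℤ.- (v ℤ.+ y) ℤ.+ (x ℤ.+ y) ≡ x ℤ.+ ℤ.- v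
    cancel = ℤ-solve

Near-square : ∀ {N K c x} → c ∈ square (+ 0 , + 0) N → Near K c x →
              x ∈ square (ℤ.- (+ K) , ℤ.- (+ K)) (N + 2 * K)
Near-square {N} {K} c∈ (near (u , v) refl u≤K v≤K)
  with (a , b) , ab∈ , refl ← ∈-map⁻ _ c∈
  with a∈ , b∈ ← ∈-cartesianProduct⁻ (upTo N) (upTo N) ab∈
  with a′ , a′< , ea ← shift-coordinate u (∈-upTo⁻ a∈) u≤K
     | b′ , b′< , eb ← shift-coordinate v (∈-upTo⁻ b∈) v≤K =
  subst (_∈ square corner (N + 2 * K)) (cong₂ _,_ ea eb)
        (∈-map⁺ (λ (a , b) → corner ⊕ (+ a , + b)) (∈-cartesianProduct⁺ (∈-upTo⁺ a′<) (∈-upTo⁺ b′<)))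
  where corner = (ℤ.- (+ K) , ℤ.- (+ K))

-- The density argument

total-size : ∀ {k} → (Fin k → Polyomino) → ℕ
total-size {zero} _ = 0
total-size {suc k} tiles = length (tiles zero) + total-size (tiles ∘ suc)

length≤total-size : ∀ {k} (tiles : Fin k → Polyomino) i → length (tiles i) ≤ total-size tiles
length≤total-size tiles zero = ℕₚ.m≤m+n _ _
length≤total-size tiles (suc i) = ℕₚ.≤-trans (length≤total-size (tiles ∘ suc) i) (ℕₚ.m≤n+m _ _)

-- M (N + 2M)² falls short of N² + M N² by 4M³(8M − 1) when N = 8M².
window-arithmetic : ∀ m s o → let M = suc m ; N = 8 * M * M in
                    N * N ≤ M * s → s ≤ o → o + N * N ≤ (N + 2 * M) * (N + 2 * M) → ⊥
window-arithmetic m s o N²≤Ms s≤o o+N²≤frame = ℕₚ.m+1+n≰m B chain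
  where
  M = suc m
  N = 8 * M * M
  B = M * ((N + 2 * M) * (N + 2 * M))
  D = (7 + 8 * m) * (4 * M * M * M)
  identity : ∀ m → let M = suc m ; N = 8 * M * M in
             M * ((N + 2 * M) * (N + 2 * M)) + (7 + 8 * m) * (4 * M * M * M) ≡ N * N + M * (N * N)
  identity = ℕ-solve
  open ℕₚ.≤-Reasoning
  chain : B + D ≤ B
  chain = begin
    B + D                       ≡⟨ identity m ⟩
    N * N + M * (N * N)         ≤⟨ ℕₚ.+-monoˡ-≤ _ (ℕₚ.≤-trans N²≤Ms (ℕₚ.*-monoʳ-≤ M s≤o)) ⟩
    M * o + M * (N * N)         ≡⟨ ℕₚ.*-distribˡ-+ M o (N * N) ⟨
    M * (o + N * N)             ≤⟨ ℕₚ.*-monoʳ-≤ M o+N²≤frame ⟩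
    B                           ∎

_≟ₚ_ : ∀ {k} (p q : Placement k) → Dec (p ≡ q)
_≟ₚ_ = ≡-dec Finₚ._≟_ (≡-dec Finₚ._≟_ _≟ᶜ_)

module SnakeTiling {k} (tiles : Fin k → Polyomino) (snake : ∀ i → SnakeTile (tiles i))
                   (f : Cell → Placement k) (covers : ∀ c → c ∈ placedCells tiles (f c))
                   (owns : ∀ c d → d ∈ placedCells tiles (f c) → f d ≡ f c) where

  open import Data.List.Membership.DecPropositional (_≟ₚ_ {k}) using () renaming (_∈?_ to _∈ₚ?_)

  cells : Placement k → List Cell
  cells = placedCells tiles

  endCells : Placement k → List Cell
  endCells (i , r , t) = copy r t (ends (tiles i))

  Used : Placement k → Set
  Used p = ∃[ c ] f c ≡ p

  owned : ∀ {p d} → Used p → d ∈ cells p → f d ≡ p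
  owned (c , refl) d∈ = owns c _ d∈

  overlap⇒≡ : ∀ {p c d} → Used p → d ∈ cells p → d ∈ cells (f c) → f c ≡ p
  overlap⇒≡ used d∈p d∈fc = trans (sym (owns _ _ d∈fc)) (owned used d∈p)

  uturnAt : (p : Placement k) → Fin 3 → UTurn (tiles (proj₁ p))
  uturnAt (i , _) = SnakeTile.uturn (snake i)

  notchAt : Placement k → Fin 3 → Cell
  notchAt p@(_ , r , t) j = move r t (notch (uturnAt p j))

  openingAt : Placement k → Fin 3 → Fin 4
  openingAt p@(_ , r , _) j = turnN (toℕ r) (opening (uturnAt p j))

  notchAt-surrounded : ∀ p j → Surrounded (cells p) (notchAt p j) (openingAt p j)
  notchAt-surrounded p@(_ , r , t) j = Surrounded-copy r t (notch-surrounded (uturnAt p j))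

  notchAt∉ : ∀ p j → notchAt p j ∉ cells p
  notchAt∉ p@(i , r , t) j n∈ = notch∉ (SnakeTile.T-free (snake i)) (uturnAt p j) (∈-copy⁻ r t n∈)

  owner-of-notch≢ : ∀ {p} j → Used p → f (notchAt p j) ≢ p
  owner-of-notch≢ {p} j _ e = notchAt∉ p j (subst (λ q → notchAt p j ∈ cells q) e (covers _))

  -- The three neighbours of a notch other than its opening belong to p, so
  -- the tile covering the notch can only continue through the opening.
  notch-is-end : ∀ {p} j → Used p → notchAt p j ∈ endCells (f (notchAt p j))
  notch-is-end {p} j used =
    ∈-copy-ends⁺ (proj₁ (proj₂ q)) (proj₂ (proj₂ q)) {tiles (proj₁ q)} {n} (covers n) only-opening
    where
    n = notchAt p j
    q = f n
    only-opening : ∀ d → n ⊕ dir d ∈ cells (f n) → d ≡ openingAt p j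
    only-opening d n⊕d∈ with d Finₚ.≟ openingAt p j
    ... | yes d≡ = d≡
    ... | no d≢ = ⊥-elim (owner-of-notch≢ j used (overlap⇒≡ used (notchAt-surrounded p j d d≢) n⊕d∈))

  cell-has-neighbour : ∀ q {x} → x ∈ cells q → ∃[ d ] x ⊕ dir d ∈ cells q
  cell-has-neighbour (i , r , t) x∈ with y , y∈ , refl ← ∈-map⁻ (move r t) x∈
    with d , y⊕d∈ ← snake-has-neighbour (snake i) y∈ = turnN (toℕ r) d , copy-step r t y⊕d∈

  notchAt-injectiveʳ : ∀ {p} j j′ → Used p → notchAt p j ≡ notchAt p j′ → j ≡ j′
  notchAt-injectiveʳ {p@(i , r , t)} j j′ used e
    with shared-notch (uturnAt p j) (uturnAt p j′) (move-injective r t e)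
  ... | inj₁ same-position = SnakeTile.uturn-injective (snake i) same-position
  ... | inj₂ enclosed with d , n⊕d∈ ← cell-has-neighbour (f (notchAt p j)) (covers (notchAt p j)) =
    ⊥-elim (owner-of-notch≢ j used (overlap⇒≡ used n⊕d∈p n⊕d∈))
    where
    n⊕d∈p : notchAt p j ⊕ dir d ∈ cells p
    n⊕d∈p = neighbour-copy r t {tiles i} {notch (uturnAt p j)} (enclosed (turnN (toℕ r * 3) d))

  notchAt-injective : ∀ {p p′} j j′ → Used p → Used p′ → notchAt p j ≡ notchAt p′ j′ → (p , j) ≡ (p′ , j′)
  notchAt-injective {p} {p′} j j′ used used′ e
    with d , d≢ , d≢′ ← another-direction (openingAt p j) (openingAt p′ j′)
    with refl ← trans (sym (owned used (notchAt-surrounded p j d d≢)))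
                      (owned used′ (subst (λ n → n ⊕ dir d ∈ cells p′) (sym e) (notchAt-surrounded p′ j′ d d≢′))) =
    cong (p ,_) (notchAt-injectiveʳ j j′ used e)

  notchAt-Near : ∀ p j {c} → c ∈ cells p → Near (length (tiles (proj₁ p)) + 1) c (notchAt p j)
  notchAt-Near p@(i , r , t) j c∈ with d , d≢ , _ ← another-direction (openingAt p j) (openingAt p j) =
    Near-trans (copy-Near r t (SnakeTile.ordered (snake i)) c∈ (notchAt-surrounded p j d d≢))
               (Near-sym (Near-step (notchAt p j) d))

  M : ℕ
  M = suc (total-size tiles)

  length-cells≤M : ∀ p → length (cells p) ≤ M
  length-cells≤M (i , r , t) = begin
    length (copy r t (tiles i))   ≡⟨ Listₚ.length-map (move r t) (tiles i) ⟩
    length (tiles i)              ≤⟨ length≤total-size tiles i ⟩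
    total-size tiles              ≤⟨ ℕₚ.n≤1+n _ ⟩
    M                             ∎
    where open ℕₚ.≤-Reasoning

  length-endCells≤2 : ∀ p → length (endCells p) ≤ 2
  length-endCells≤2 (i , r , t) = ℕₚ.≤-trans (ℕₚ.≤-reflexive (Listₚ.length-map (move r t) (ends (tiles i))))
    (length-ends≤2 (SnakeTile.unique (snake i)) (SnakeTile.ordered (snake i)) (SnakeTile.T-free (snake i)))

  notchAt-Near-M : ∀ p j {c} → c ∈ cells p → Near M c (notchAt p j)
  notchAt-Near-M p@(i , _) j c∈ = Near-mono {length (tiles i) + 1}
    (ℕₚ.≤-trans (ℕₚ.≤-reflexive (ℕₚ.+-comm _ 1)) (s≤s (length≤total-size tiles i))) (notchAt-Near p j c∈)

  module Window (N : ℕ) where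

    origin corner : Cell
    origin = (+ 0 , + 0)
    corner = (ℤ.- (+ M) , ℤ.- (+ M))

    window frame : List Cell
    window = square origin N
    frame = square corner (N + 2 * M)

    meeting : List (Placement k)
    meeting = deduplicate _≟ₚ_ (map f window)

    ∈-meeting⁺ : ∀ {c} → c ∈ window → f c ∈ meeting
    ∈-meeting⁺ c∈ = ∈-deduplicate⁺ _≟ₚ_ (∈-map⁺ f c∈)

    ∈-meeting⁻ : ∀ {p} → p ∈ meeting → ∃[ c ] c ∈ window × f c ≡ p
    ∈-meeting⁻ p∈ with c , c∈ , refl ← ∈-map⁻ f (∈-deduplicate⁻ _≟ₚ_ (map f window) p∈) = c , c∈ , refl

    meeting-used : ∀ {p} → p ∈ meeting → Used p
    meeting-used p∈ with c , _ , e ← ∈-meeting⁻ p∈ = c , e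

    window≤ : N * N ≤ M * length meeting
    window≤ = begin
      N * N                                    ≡⟨ length-square origin N ⟨
      length window                            ≤⟨ Unique⇒length≤ (square-unique origin N) covered ⟩
      length (concatMap cells meeting)         ≤⟨ length-concatMap≤ cells meeting (λ {p} _ → length-cells≤M p) ⟩
      M * length meeting                       ∎
      where
      open ℕₚ.≤-Reasoning
      covered : window ⊆ concatMap cells meeting
      covered {c} c∈ = ∈-concatMap⁺ cells (lose (∈-meeting⁺ c∈) (covers c))

    notches : List Cell
    notches = map (uncurry notchAt) (cartesianProduct meeting (allFin 3))

    notches-unique : Unique notches
    notches-unique = Unique-map-on (uncurry notchAt)
      (Uniqueₚ.cartesianProduct⁺ (DecUniqueₚ.deduplicate-! _≟ₚ_ (map f window)) (Uniqueₚ.allFin⁺ 3))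
      λ {(p , j)} {(p′ , j′)} pj∈ pj′∈ → notchAt-injective j j′ (used pj∈) (used pj′∈)
      where
      used : ∀ {p j} → (p , j) ∈ cartesianProduct meeting (allFin 3) → Used p
      used pj∈ = meeting-used (proj₁ (∈-cartesianProduct⁻ meeting (allFin 3) pj∈))

    ∈-notches⁻ : ∀ {n} → n ∈ notches → ∃[ p ] ∃[ j ] p ∈ meeting × n ≡ notchAt p j
    ∈-notches⁻ n∈ with (p , j) , pj∈ , refl ← ∈-map⁻ (uncurry notchAt) n∈ =
      p , j , proj₁ (∈-cartesianProduct⁻ meeting (allFin 3) pj∈) , refl

    captured? : (n : Cell) → Dec (f n ∈ meeting)
    captured? n = f n ∈ₚ? meeting

    captured escaped : List Cell
    captured = filter captured? notches
    escaped = filter (¬? ∘ captured?) notches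

    captured≤ : length captured ≤ 2 * length meeting
    captured≤ = ℕₚ.≤-trans (Unique⇒length≤ (Uniqueₚ.filter⁺ captured? notches-unique) at-ends)
                           (length-concatMap≤ endCells meeting (λ {p} _ → length-endCells≤2 p))
      where
      at-ends : captured ⊆ concatMap endCells meeting
      at-ends n∈ with n∈notches , owner∈ ← ∈-filter⁻ captured? {xs = notches} n∈
        with p , j , p∈ , refl ← ∈-notches⁻ n∈notches =
        ∈-concatMap⁺ endCells (lose owner∈ (notch-is-end j (meeting-used p∈)))

    -- Three notches per tile, but the captured ones are ends of tiles and each tile has two ends.
    meeting≤escaped : length meeting ≤ length escaped
    meeting≤escaped = ℕₚ.+-cancelˡ-≤ (2 * length meeting) _ _ (begin
      2 * length meeting + length meeting        ≡⟨ triple (length meeting) ⟩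
      length meeting * 3                         ≡⟨ length-notches ⟨
      length notches                             ≡⟨ length-filter-split captured? notches ⟨
      length captured + length escaped           ≤⟨ ℕₚ.+-monoˡ-≤ _ captured≤ ⟩
      2 * length meeting + length escaped        ∎)
      where
      open ℕₚ.≤-Reasoning
      triple : ∀ s → 2 * s + s ≡ s * 3
      triple = ℕ-solve
      length-notches : length notches ≡ length meeting * 3
      length-notches = trans (Listₚ.length-map (uncurry notchAt) (cartesianProduct meeting (allFin 3)))
                               (length-cartesianProduct meeting (allFin 3))

    escaped+window≤ : length escaped + N * N ≤ (N + 2 * M) * (N + 2 * M)
    escaped+window≤ = begin
      length escaped + N * N               ≡⟨ cong (λ w → length escaped + w) (length-square origin N) ⟨
      length escaped + length window       ≡⟨ Listₚ.length-++ escaped ⟨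
      length (escaped ++ window)           ≤⟨ Unique⇒length≤ unique inside ⟩
      length frame                         ≡⟨ length-square corner (N + 2 * M) ⟩
      (N + 2 * M) * (N + 2 * M)            ∎
      where
      open ℕₚ.≤-Reasoning
      escaped⁻ : ∀ {n} → n ∈ escaped → n ∈ notches × ¬ f n ∈ meeting
      escaped⁻ = ∈-filter⁻ (¬? ∘ captured?) {xs = notches}
      unique : Unique (escaped ++ window)
      unique = Uniqueₚ.++⁺ (Uniqueₚ.filter⁺ (¬? ∘ captured?) notches-unique) (square-unique origin N)
                           λ (n∈ , n∈window) → proj₂ (escaped⁻ n∈) (∈-meeting⁺ n∈window)
      inside : escaped ++ window ⊆ frame
      inside n∈ with ∈-++⁻ escaped n∈
      ... | inj₂ n∈window = Near-square {N} {M} n∈window (Near-refl _)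
      ... | inj₁ n∈escaped with p , j , p∈ , refl ← ∈-notches⁻ (proj₁ (escaped⁻ n∈escaped))
                           with c , c∈window , refl ← ∈-meeting⁻ p∈ =
        Near-square {N} {M} c∈window (notchAt-Near-M (f c) j (covers c))

  no-tiling : ⊥
  no-tiling = window-arithmetic (total-size tiles) (length meeting) (length escaped)
                                window≤ meeting≤escaped escaped+window≤
    where open Window (8 * M * M)

no-snake-tiling : ∀ {k} (tiles : Fin k → Polyomino) → (∀ i → SnakeTile (tiles i)) → ¬ TilesPlane tiles
no-snake-tiling tiles snake (f , covers , owns) = SnakeTiling.no-tiling tiles snake f covers owns

TilesPlane-resp-↭ : ∀ {k} {tiles tiles′ : Fin k → Polyomino} → (∀ i → tiles′ i ↭ tiles i) →
                    TilesPlane tiles → TilesPlane tiles′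
TilesPlane-resp-↭ {tiles = tiles} {tiles′} perm (f , covers , owns) =
  f , (λ c → ∈-resp-↭ (↭-sym (same-cells (f c))) (covers c))
    , (λ c d d∈ → owns c d (∈-resp-↭ (same-cells (f c)) d∈))
  where
  same-cells : ∀ p → placedCells tiles′ p ↭ placedCells tiles p
  same-cells (i , r , t) = Permₚ.map⁺ (move r t) (perm i)

good-snakes-do-not-tile : (k : ℕ) (tiles : Fin k → Polyomino) → ((i : Fin k) → GoodSnake (tiles i)) →
                          ¬ TilesPlane tiles
good-snakes-do-not-tile k tiles good =
  no-snake-tiling (λ i → proj₁ (spine (good i))) (λ i → proj₂ (proj₂ (spine (good i))))
  ∘ TilesPlane-resp-↭ (λ i → proj₁ (proj₂ (spine (good i))))

proposition4 : ((P : Polyomino) → GoodSnake P → ¬ TilesPlane {1} (λ _ → P))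
    × ((k : ℕ) (tiles : Fin k → Polyomino) → ((i : Fin k) → GoodSnake (tiles i)) → ¬ TilesPlane tiles)
proposition4 = (λ P good → good-snakes-do-not-tile 1 (λ _ → P) (λ _ → good)) , good-snakes-do-not-tile
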